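{- For every $l\le 3$ and $d\ge l+4$, every level-$l$ $4$-cube in $Q^d$ is $\mathbf{0}$-stackable. For every $d\ge 8$, the union of all level-$4$ $3$-cubes in $Q^d$ is $\mathbf{0}$-stackable.
   Context: $Q^d$ has vertex set $\{0,1\}^d$, adjacency meaning differing in exactly one coordinate; $\mathbf{0}$ is the all-zeros vertex. Writing $Q^d=Q^{d-k}\,\square\,Q^k$, for each $S\subseteq\{1,\dots,d-k\}$ the $k$-cube labeled $S$ is the set of vertices whose first $d-k$ coordinates are the indicator vector of $S$ (last $k$ coordinates arbitrary); its level is $|S|$. A configuration is a function $C:V\to\mathbb{N}$ (numbers of cups); a cup stacking move from $u$ to $v$ is allowed when $C(u)\ge1$, $C(v)\ge1$ and $\mathrm{dist}_{Q^d}(u,v)=C(u)$, and moves all cups of $u$ onto $v$. A set $U$ of vertices of $Q^d$ is $\mathbf{0}$-stackable if, starting from the configuration with one cup on each vertex of $U\cup\{\mathbf{0}\}$ and none elsewhere, some sequence of moves in $Q^d$ puts all cups on $\mathbf{0}$. -}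

module Defs where

open import Data.Nat using (ℕ; zero; suc; _+_; _≤_)
open import Data.Bool using (Bool; true; false; if_then_else_)
open import Data.Vec using (Vec; []; _∷_; take; replicate)
open import Data.Vec.Properties using (≡-dec)
import Data.Bool as B
open import Data.Product using (Σ; ∃; _×_; _,_)
open import Relation.Nullary using (does; ¬_)
open import Data.Sum using (_⊎_)
open import Relation.Binary.PropositionalEquality using (_≡_)
open import Relation.Binary.Construct.Closure.ReflexiveTransitive using (Star)

Vertex : ℕ → Set
Vertex d = Vec Bool d

𝟎 : ∀ {d} → Vertex d
𝟎 {d} = replicate d false

_≟V_ : ∀ {d} (u v : Vertex d) → Relation.Nullary.Dec (u ≡ v)
_≟V_ = ≡-dec B._≟_

-- graph distance in Q^d = Hamming distance
dist : ∀ {d} → Vertex d → Vertex d → ℕ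
dist [] [] = 0
dist (x ∷ xs) (y ∷ ys) = (if does (x B.≟ y) then 0 else 1) + dist xs ys

weight : ∀ {n} → Vec Bool n → ℕ
weight [] = 0
weight (true ∷ xs) = suc (weight xs)
weight (false ∷ xs) = weight xs

Config : ℕ → Set
Config d = Vertex d → ℕ

Move : ∀ {d} → Config d → Config d → Set
Move {d} C C' =
  Σ (Vertex d) λ u → Σ (Vertex d) λ v →
    (1 ≤ C u) × (1 ≤ C v) × (dist u v ≡ C u) ×
    (C' u ≡ 0) × (C' v ≡ C v + C u) ×
    (∀ w → (w ≡ u → Data.Empty.⊥) → (w ≡ v → Data.Empty.⊥) → C' w ≡ C w)
  where import Data.Empty

Reachable : ∀ {d} → Config d → Config d → Set
Reachable = Star Move

VSet : ℕ → Set₁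
VSet d = Vertex d → Set

IsInitial : ∀ {d} → VSet d → Config d → Set
IsInitial U C = ∀ w → ((U w ⊎ w ≡ 𝟎) → C w ≡ 1) × (¬ (U w ⊎ w ≡ 𝟎) → C w ≡ 0)

allOnZero : ∀ {d} → Config d → Set
allOnZero C = ∀ w → ¬ (w ≡ 𝟎) → C w ≡ 0

ZeroStackable : ∀ {d} → VSet d → Set
ZeroStackable U = ∃ λ C₀ → IsInitial U C₀ × ∃ λ C → Reachable C₀ C × allOnZero C

-- Q^(n+k) = Q^n □ Q^k : the k-cube labeled S ⊆ {1..n} (S as indicator vector),
-- i.e. vertices whose first n coordinates equal S.  Its level is weight S.
kCube : (n k : ℕ) → Vec Bool n → VSet (n + k)
kCube n k S w = take n w ≡ S

unionLevelCubes : (n k l : ℕ) → VSet (n + k)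
unionLevelCubes n k l w = ∃ λ (S : Vec Bool n) → weight S ≡ l × kCube n k S w

-- A thinning of the label coordinates, together with the free coordinates, embeds a smaller
-- cube isometrically into Q^d with 𝟎 ↦ 𝟎, so a sequence of moves stacking a set R onto 𝟎 inside
-- the small cube can be replayed in Q^d, as long as it never moves cups away from 𝟎 (whose pile
-- in Q^d may be larger). A level-l 4-cube lies in such a copy of Q^(l+4). The labels of weight j
-- in n coordinates split, by their first coordinate, into labels of weight j and j−1 in n−1
-- coordinates; unfolding this recursion down to "j ones among j+1 coordinates" (and, for j = 1,
-- pairs and a triple of coordinates) partitions the level-4 labels into blocks, each lying in a
-- copy of Q^8 or Q^9. Every small case is settled by an explicit script checked by evaluation,
-- and the blocks are stacked one after the other onto the growing pile at 𝟎.

module Submission where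

open import Defs
open import Data.Nat using (ℕ; zero; suc; _+_; _≤_; _≤?_; _≡ᵇ_; z≤n; s≤s; _%_; _/_)
open import Data.Nat.Properties
  using ( _≟_; ≤-trans; n≮0; ≤-pred; +-identityʳ; +-assoc; +-suc; m≤m+n; m≤n+m; n≤0⇒n≡0
        ; +-cancelʳ-≤; ≡ᵇ⇒≡; ≡⇒≡ᵇ; m≤n⇒∃[o]m+o≡n)
open import Data.Bool using (Bool; true; false; if_then_else_; _∧_; not; T)
open import Data.Bool.Properties using (T?; T-∧; T-≡; ∧-zeroʳ; ∧-identityʳ)
open import Data.Unit using (⊤; tt)
open import Data.Empty using (⊥-elim)
open import Data.Vec using (Vec; []; _∷_; take)
open import Data.List using (List; []; _∷_; map; _++_)
open import Data.Product using (∃-syntax; _×_; _,_; proj₁; proj₂; map₂)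
open import Data.Sum using (_⊎_; inj₁; inj₂)
import Data.Sum as Sum
open import Function using (_∘_; _⇔_; mk⇔; Equivalence)
open import Relation.Nullary using (Dec; yes; no; ¬_; ¬?; _×-dec_; _⊎-dec_; _→-dec_; contradiction)
open import Relation.Nullary.Decidable using (True; toWitness; map′; toSum)
open import Relation.Binary.PropositionalEquality
open import Relation.Binary.Construct.Closure.ReflexiveTransitive using (ε; _◅_; _◅◅_)

indicator : Bool → ℕ
indicator b = if b then 1 else 0

T-∧-split : ∀ {a b} → T (a ∧ b) → T a × T b
T-∧-split = Equivalence.to T-∧

if-T : ∀ {A : Set} {b} {x y : A} → T b → (if b then x else y) ≡ x
if-T {b = true} _ = refl

if-¬T : ∀ {A : Set} {b} {x y : A} → ¬ T b → (if b then x else y) ≡ y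
if-¬T {b = false} _   = refl
if-¬T {b = true}  ¬tt = contradiction tt ¬tt

dist-refl : ∀ {d} (x : Vertex d) → dist x x ≡ 0
dist-refl [] = refl
dist-refl (true ∷ x) = dist-refl x
dist-refl (false ∷ x) = dist-refl x

all-vertices? : ∀ {d} {P : Vertex d → Set} → (∀ x → Dec (P x)) → Dec (∀ x → P x)
all-vertices? {zero} P? = map′ (λ p → λ { [] → p }) (λ f → f []) (P? [])
all-vertices? {suc d} P? =
  map′ (λ (f , t) → λ { (false ∷ x) → f x ; (true ∷ x) → t x })
       (λ f → (λ x → f (false ∷ x)) , (λ x → f (true ∷ x)))
       (all-vertices? (P? ∘ (false ∷_)) ×-dec all-vertices? (P? ∘ (true ∷_)))

_↝_ : ∀ {d} → Config d → Config d → Set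
C ↝ D = ∃[ D′ ] Reachable C D′ × D′ ≗ D

module _ {d : ℕ} where

  ↝-refl : {C : Config d} → C ↝ C
  ↝-refl = _ , ε , λ _ → refl

  _◅↝_ : {C D E : Config d} → Move C D → D ↝ E → C ↝ E
  m ◅↝ (E′ , steps , E′≗E) = E′ , m ◅ steps , E′≗E

  move-respˡ : {C C′ D : Config d} → C ≗ C′ → Move C′ D → Move C D
  move-respˡ C≗C′ (u , v , u-cups , v-cups , dist≡ , emptied , filled , others) =
    u , v , subst (1 ≤_) (sym (C≗C′ u)) u-cups , subst (1 ≤_) (sym (C≗C′ v)) v-cups ,
    trans dist≡ (sym (C≗C′ u)) , emptied , trans filled (sym (cong₂ _+_ (C≗C′ v) (C≗C′ u))) ,
    λ w w≢u w≢v → trans (others w w≢u w≢v) (sym (C≗C′ w))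

  ↝-respˡ : {C C′ D : Config d} → C ≗ C′ → C′ ↝ D → C ↝ D
  ↝-respˡ C≗C′ (D′ , ε , D′≗D) = _ , ε , λ w → trans (C≗C′ w) (D′≗D w)
  ↝-respˡ C≗C′ (D′ , m ◅ steps , D′≗D) = move-respˡ C≗C′ m ◅↝ (D′ , steps , D′≗D)

  ↝-respʳ : {C D E : Config d} → C ↝ D → D ≗ E → C ↝ E
  ↝-respʳ (D′ , steps , D′≗D) D≗E = D′ , steps , λ w → trans (D′≗D w) (D≗E w)

  ↝-trans : {C D E : Config d} → C ↝ D → D ↝ E → C ↝ E
  ↝-trans (D′ , steps , D′≗D) D↝E with ↝-respˡ D′≗D D↝E
  ... | E′ , steps′ , E′≗E = E′ , steps ◅◅ steps′ , E′≗E

infix 4 _⊑_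

data _⊑_ : ℕ → ℕ → Set where
  done : 0 ⊑ 0
  skip : ∀ {m n} → m ⊑ n → m ⊑ suc n
  keep : ∀ {m n} → m ⊑ n → suc m ⊑ suc n

empty : ∀ n → 0 ⊑ n
empty zero = done
empty (suc n) = skip (empty n)

full : ∀ n → n ⊑ n
full zero = done
full (suc n) = keep (full n)

module Subcube (k : ℕ) where

  embed : ∀ {m n} → m ⊑ n → Vertex (m + k) → Vertex (n + k)
  embed done x = x
  embed (skip p) x = false ∷ embed p x
  embed (keep p) (b ∷ x) = b ∷ embed p x

  restrict : ∀ {m n} → m ⊑ n → Vertex (n + k) → Vertex (m + k)
  restrict done w = w
  restrict (skip p) (_ ∷ w) = restrict p w
  restrict (keep p) (b ∷ w) = b ∷ restrict p w

  inSubcube : ∀ {m n} → m ⊑ n → Vertex (n + k) → Bool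
  inSubcube done _ = true
  inSubcube (skip p) (b ∷ w) = not b ∧ inSubcube p w
  inSubcube (keep p) (_ ∷ w) = inSubcube p w

  restrict-embed : ∀ {m n} (p : m ⊑ n) (x : Vertex (m + k)) → restrict p (embed p x) ≡ x
  restrict-embed done x = refl
  restrict-embed (skip p) x = restrict-embed p x
  restrict-embed (keep p) (b ∷ x) = cong (b ∷_) (restrict-embed p x)

  embed-restrict : ∀ {m n} (p : m ⊑ n) (w : Vertex (n + k)) → T (inSubcube p w) → embed p (restrict p w) ≡ w
  embed-restrict done w _ = refl
  embed-restrict (skip p) (false ∷ w) w∈ = cong (false ∷_) (embed-restrict p w w∈)
  embed-restrict (keep p) (b ∷ w) w∈ = cong (b ∷_) (embed-restrict p w w∈)

  embed-inSubcube : ∀ {m n} (p : m ⊑ n) (x : Vertex (m + k)) → T (inSubcube p (embed p x))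
  embed-inSubcube done x = tt
  embed-inSubcube (skip p) x = embed-inSubcube p x
  embed-inSubcube (keep p) (b ∷ x) = embed-inSubcube p x

  dist-embed : ∀ {m n} (p : m ⊑ n) (x y : Vertex (m + k)) → dist (embed p x) (embed p y) ≡ dist x y
  dist-embed done x y = refl
  dist-embed (skip p) x y = dist-embed p x y
  dist-embed (keep p) (a ∷ x) (b ∷ y) = cong (_ +_) (dist-embed p x y)

  embed-𝟎 : ∀ {m n} (p : m ⊑ n) → embed p 𝟎 ≡ 𝟎
  embed-𝟎 done = refl
  embed-𝟎 (skip p) = cong (false ∷_) (embed-𝟎 p)
  embed-𝟎 (keep p) = cong (false ∷_) (embed-𝟎 p)

  restrict-𝟎 : ∀ {m n} (p : m ⊑ n) → restrict p 𝟎 ≡ 𝟎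
  restrict-𝟎 done = refl
  restrict-𝟎 (skip p) = restrict-𝟎 p
  restrict-𝟎 (keep p) = cong (false ∷_) (restrict-𝟎 p)

  embed-≢𝟎 : ∀ {m n} (p : m ⊑ n) {x : Vertex (m + k)} → x ≢ 𝟎 → embed p x ≢ 𝟎
  embed-≢𝟎 p {x} x≢𝟎 e = x≢𝟎 (begin
    x                     ≡⟨ sym (restrict-embed p x) ⟩
    restrict p (embed p x) ≡⟨ cong (restrict p) e ⟩
    restrict p 𝟎          ≡⟨ restrict-𝟎 p ⟩
    𝟎                     ∎)
    where open ≡-Reasoning

stack : ∀ {d} → Config d → Vertex d → Vertex d → Config d
stack C u v x with x ≟V u | x ≟V v
... | yes _ | _     = 0
... | no _  | yes _ = C v + C u
... | no _  | no _  = C x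

module _ {d : ℕ} (C : Config d) (u v : Vertex d) where

  stack-source : stack C u v u ≡ 0
  stack-source with u ≟V u
  ... | yes _   = refl
  ... | no u≢u = contradiction refl u≢u

  stack-target : u ≢ v → stack C u v v ≡ C v + C u
  stack-target u≢v with v ≟V u | v ≟V v
  ... | yes v≡u | _      = contradiction (sym v≡u) u≢v
  ... | no _    | yes _   = refl
  ... | no _    | no v≢v = contradiction refl v≢v

  stack-other : ∀ {x} → x ≢ u → x ≢ v → stack C u v x ≡ C x
  stack-other {x} x≢u x≢v with x ≟V u | x ≟V v
  ... | yes x≡u | _       = contradiction x≡u x≢u
  ... | no _    | yes x≡v = contradiction x≡v x≢v
  ... | no _    | no _    = refl

-- A move from R ∖ {𝟎} onto R ∪ {𝟎}. As 𝟎 is never a source, such a move stays legal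
-- however many cups 𝟎 holds, which is what lets a script run inside a larger configuration.
LegalStep : ∀ {d} → (Vertex d → Bool) → Config d → Vertex d → Vertex d → Set
LegalStep R C u v = u ≢ 𝟎 × T (R u) × (v ≡ 𝟎 ⊎ T (R v) × 1 ≤ C v) × 1 ≤ C u × dist u v ≡ C u

legal-step? : ∀ {d} R C (u v : Vertex d) → Dec (LegalStep R C u v)
legal-step? R C u v =
  ¬? (u ≟V 𝟎) ×-dec T? (R u) ×-dec (v ≟V 𝟎 ⊎-dec T? (R v) ×-dec 1 ≤? C v) ×-dec
  1 ≤? C u ×-dec dist u v ≟ C u

Script : ℕ → Set
Script d = List (Vertex d × Vertex d)

run : ∀ {d} → Config d → Script d → Config d
run C [] = C
run C ((u , v) ∷ s) = run (stack C u v) s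

Legal : ∀ {d} → (Vertex d → Bool) → Config d → Script d → Set
Legal R C [] = ⊤
Legal R C ((u , v) ∷ s) = LegalStep R C u v × Legal R (stack C u v) s

legal? : ∀ {d} R C (s : Script d) → Dec (Legal R C s)
legal? R C [] = yes tt
legal? R C ((u , v) ∷ s) = legal-step? R C u v ×-dec legal? R (stack C u v) s

Cleared : ∀ {d} → (Vertex d → Bool) → Config d → Set
Cleared R C = ∀ x → x ≢ 𝟎 → T (R x) → C x ≡ 0

cleared? : ∀ {d} R (C : Config d) → Dec (Cleared R C)
cleared? R C = all-vertices? λ x → ¬? (x ≟V 𝟎) →-dec T? (R x) →-dec C x ≟ 0

-- The cups of 𝟎 belong to the surrounding configuration; here 𝟎 only counts what arrives.
initial : ∀ {d} → (Vertex d → Bool) → Config d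
initial R x with x ≟V 𝟎
... | yes _ = 0
... | no _  = indicator (R x)

initial-𝟎 : ∀ {d} (R : Vertex d → Bool) → initial R 𝟎 ≡ 0
initial-𝟎 {d} R with 𝟎 {d} ≟V 𝟎
... | yes _   = refl
... | no 𝟎≢𝟎 = contradiction refl 𝟎≢𝟎

initial-∈ : ∀ {d} (R : Vertex d → Bool) {x} → x ≢ 𝟎 → T (R x) → initial R x ≡ 1
initial-∈ R {x} x≢𝟎 x∈R with x ≟V 𝟎
... | yes x≡𝟎 = contradiction x≡𝟎 x≢𝟎
... | no _    = cong indicator (Equivalence.to T-≡ x∈R)

record Certificate {d : ℕ} (R : Vertex d → Bool) : Set where
  field
    script : Script d
    legal  : Legal R (initial R) script
    clears : Cleared R (run (initial R) script)

  final : Config d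
  final = run (initial R) script

checked : ∀ {d} {R : Vertex d → Bool} (s : Script d) →
  {True (legal? R (initial R) s)} → {True (cleared? R (run (initial R) s))} → Certificate R
checked s {legal} {clears} = record { script = s ; legal = toWitness legal ; clears = toWitness clears }

module Lift {m n : ℕ} (k : ℕ) (p : m ⊑ n) (R : Vertex (m + k) → Bool) where
  open Subcube k

  member : Vertex (n + k) → Bool
  member w = inSubcube p w ∧ R (restrict p w)

  lift : Config (m + k) → Config (n + k) → Config (n + k)
  lift c C w with w ≟V 𝟎
  ... | yes _ = C w + c 𝟎
  ... | no _  = if member w then c (restrict p w) else C w

  restrict-≢𝟎 : ∀ {w} → w ≢ 𝟎 → T (member w) → restrict p w ≢ 𝟎
  restrict-≢𝟎 {w} w≢𝟎 w∈ r≡𝟎 = w≢𝟎 (begin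
    w                        ≡⟨ sym (embed-restrict p w (proj₁ (T-∧-split w∈))) ⟩
    embed p (restrict p w)   ≡⟨ cong (embed p) r≡𝟎 ⟩
    embed p 𝟎                ≡⟨ embed-𝟎 p ⟩
    𝟎                        ∎)
    where open ≡-Reasoning

  restrict-≢ : ∀ {w x} → T (member w) → w ≢ embed p x → restrict p w ≢ x
  restrict-≢ {w} w∈ w≢ r≡x =
    w≢ (trans (sym (embed-restrict p w (proj₁ (T-∧-split w∈)))) (cong (embed p) r≡x))

  member-shape : ∀ {w} → T (member w) → T (R (restrict p w))
  member-shape = proj₂ ∘ T-∧-split

  embed-member : ∀ {x} → T (R x) → T (member (embed p x))
  embed-member {x} x∈R =
    Equivalence.from T-∧ (embed-inSubcube p x , subst (T ∘ R) (sym (restrict-embed p x)) x∈R)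

  module _ (c : Config (m + k)) (C : Config (n + k)) where

    lift-𝟎 : lift c C 𝟎 ≡ C 𝟎 + c 𝟎
    lift-𝟎 with 𝟎 {n + k} ≟V 𝟎
    ... | yes _   = refl
    ... | no 𝟎≢𝟎 = contradiction refl 𝟎≢𝟎

    lift-member : ∀ {w} → w ≢ 𝟎 → T (member w) → lift c C w ≡ c (restrict p w)
    lift-member {w} w≢𝟎 w∈ with w ≟V 𝟎
    ... | yes w≡𝟎 = contradiction w≡𝟎 w≢𝟎
    ... | no _    = if-T w∈

    lift-outside : ∀ {w} → w ≢ 𝟎 → ¬ T (member w) → lift c C w ≡ C w
    lift-outside {w} w≢𝟎 w∉ with w ≟V 𝟎
    ... | yes w≡𝟎 = contradiction w≡𝟎 w≢𝟎
    ... | no _    = if-¬T w∉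

    lift-embed : ∀ {x} → x ≢ 𝟎 → T (R x) → lift c C (embed p x) ≡ c x
    lift-embed {x} x≢𝟎 x∈R =
      trans (lift-member (embed-≢𝟎 p x≢𝟎) (embed-member x∈R)) (cong c (restrict-embed p x))

  Receives : Config (m + k) → Config (n + k) → Vertex (m + k) → Vertex (m + k) → Set
  Receives c C u v = 1 ≤ lift c C (embed p v) × lift (stack c u v) C (embed p v) ≡ lift c C (embed p v) + c u

  lift-target-𝟎 : ∀ c C {u} → u ≢ 𝟎 → 1 ≤ C 𝟎 → Receives c C u 𝟎
  lift-target-𝟎 c C {u} u≢𝟎 C𝟎 rewrite embed-𝟎 p | lift-𝟎 c C | lift-𝟎 (stack c u 𝟎) C =
    ≤-trans C𝟎 (m≤m+n _ _) ,
    trans (cong (C 𝟎 +_) (stack-target c u 𝟎 u≢𝟎)) (sym (+-assoc (C 𝟎) (c 𝟎) (c u)))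

  lift-target : ∀ c C {u v} → u ≢ 𝟎 → u ≢ v → (v ≡ 𝟎 ⊎ T (R v) × 1 ≤ c v) → 1 ≤ C 𝟎 →
    Receives c C u v
  lift-target c C u≢𝟎 _ (inj₁ refl) C𝟎 = lift-target-𝟎 c C u≢𝟎 C𝟎
  lift-target c C {u} {v} u≢𝟎 u≢v (inj₂ (v∈R , v-cups)) C𝟎 with v ≟V 𝟎
  ... | yes refl = lift-target-𝟎 c C u≢𝟎 C𝟎
  ... | no v≢𝟎 rewrite lift-embed c C v≢𝟎 v∈R | lift-embed (stack c u v) C v≢𝟎 v∈R =
    v-cups , stack-target c u v u≢v

  lift-others : ∀ c C {u v w} → u ≢ 𝟎 → w ≢ embed p u → w ≢ embed p v →
    lift (stack c u v) C w ≡ lift c C w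
  lift-others c C {u} {v} {w} u≢𝟎 w≢u w≢v with w ≟V 𝟎
  ... | yes refl = cong (C 𝟎 +_) (stack-other c u v (u≢𝟎 ∘ sym) 𝟎≢v)
    where 𝟎≢v = λ 𝟎≡v → w≢v (trans (sym (embed-𝟎 p)) (cong (embed p) 𝟎≡v))
  ... | no _ with member w in w∈
  ...   | true  = stack-other c u v (restrict-≢ w∈′ w≢u) (restrict-≢ w∈′ w≢v)
    where w∈′ = Equivalence.from T-≡ w∈
  ...   | false = refl

  lift-move : ∀ c C {u v} → 1 ≤ C 𝟎 → LegalStep R c u v → Move (lift c C) (lift (stack c u v) C)
  lift-move c C {u} {v} C𝟎 (u≢𝟎 , u∈R , target , u-cups , dist≡) =
    embed p u , embed p v ,
    subst (1 ≤_) (sym source) u-cups , proj₁ filled ,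
    trans (dist-embed p u v) (trans dist≡ (sym source)) ,
    trans (lift-embed (stack c u v) C u≢𝟎 u∈R) (stack-source c u v) ,
    trans (proj₂ filled) (cong (_ +_) (sym source)) ,
    λ w w≢u w≢v → lift-others c C u≢𝟎 w≢u w≢v
    where
      source : lift c C (embed p u) ≡ c u
      source = lift-embed c C u≢𝟎 u∈R
      u≢v : u ≢ v
      u≢v refl = n≮0 (subst (1 ≤_) (trans (sym dist≡) (dist-refl u)) u-cups)
      filled = lift-target c C u≢𝟎 u≢v target C𝟎

  lift-script : ∀ c C s → 1 ≤ C 𝟎 → Legal R c s → lift c C ↝ lift (run c s) C
  lift-script c C [] C𝟎 _ = ↝-refl
  lift-script c C ((u , v) ∷ s) C𝟎 (step , rest) =
    lift-move c C C𝟎 step ◅↝ lift-script (stack c u v) C s C𝟎 rest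

count : ∀ {A : Set} → (A → Bool) → List A → ℕ
count P [] = 0
count P (x ∷ xs) = indicator (P x) + count P xs

count-++ : ∀ {A : Set} (P : A → Bool) xs ys → count P (xs ++ ys) ≡ count P xs + count P ys
count-++ P [] ys = refl
count-++ P (x ∷ xs) ys = trans (cong (indicator (P x) +_) (count-++ P xs ys)) (sym (+-assoc (indicator (P x)) _ _))

count-map : ∀ {A B : Set} (P : B → Bool) (f : A → B) xs → count P (map f xs) ≡ count (P ∘ f) xs
count-map P f [] = refl
count-map P f (x ∷ xs) = cong (indicator (P (f x)) +_) (count-map P f xs)

count-none : ∀ {A : Set} (P : A → Bool) xs → (∀ x → P x ≡ false) → count P xs ≡ 0
count-none P [] _ = refl
count-none P (x ∷ xs) none rewrite none x = count-none P xs none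

record Block (n k : ℕ) : Set where
  field
    dim         : ℕ
    thinning    : dim ⊑ n
    shape       : Vertex (dim + k) → Bool
    certificate : Certificate shape

  open Lift k thinning shape public
    using (member; lift; lift-𝟎; lift-member; lift-outside; lift-script; restrict-≢𝟎; member-shape)
  open Subcube k public using (restrict)

multiplicity : ∀ {n k} → List (Block n k) → Vertex (n + k) → ℕ
multiplicity bs w = count (λ b → Block.member b w) bs

pile : ∀ {n k} → List (Block n k) → ℕ → Config (n + k)
pile bs K w with w ≟V 𝟎
... | yes _ = K
... | no _  = multiplicity bs w

pile-𝟎 : ∀ {n k} (bs : List (Block n k)) K → pile bs K 𝟎 ≡ K
pile-𝟎 {n} {k} bs K with 𝟎 {n + k} ≟V 𝟎
... | yes _   = refl
... | no 𝟎≢𝟎 = contradiction refl 𝟎≢𝟎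

pile-≢𝟎 : ∀ {n k} (bs : List (Block n k)) K {w} → w ≢ 𝟎 → pile bs K w ≡ multiplicity bs w
pile-≢𝟎 bs K {w} w≢𝟎 with w ≟V 𝟎
... | yes w≡𝟎 = contradiction w≡𝟎 w≢𝟎
... | no _    = refl

stack-block : ∀ {n k} (b : Block n k) bs {K} →
  (∀ w → T (Block.member b w) → multiplicity bs w ≡ 0) →
  1 ≤ K → pile (b ∷ bs) K ↝ pile bs (K + Certificate.final (Block.certificate b) 𝟎)
stack-block b bs {K} disjoint K≥1 =
  ↝-respˡ before (↝-respʳ (lift-script (initial shape) (pile bs K) script K≥1′ legal) after)
  where
    open Block b
    open Certificate certificate
    open ≡-Reasoning

    K≥1′ : 1 ≤ pile bs K 𝟎
    K≥1′ = subst (1 ≤_) (sym (pile-𝟎 bs K)) K≥1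

    before : ∀ w → pile (b ∷ bs) K w ≡ lift (initial shape) (pile bs K) w
    before w with toSum (w ≟V 𝟎) | T? (member w)
    ... | inj₁ refl | _ = begin
      pile (b ∷ bs) K 𝟎                          ≡⟨ pile-𝟎 (b ∷ bs) K ⟩
      K                                          ≡⟨ sym (+-identityʳ K) ⟩
      K + 0                                      ≡⟨ sym (cong₂ _+_ (pile-𝟎 bs K) (initial-𝟎 shape)) ⟩
      pile bs K 𝟎 + initial shape 𝟎              ≡⟨ sym (lift-𝟎 _ _) ⟩
      lift (initial shape) (pile bs K) 𝟎         ∎
    ... | inj₂ w≢𝟎 | yes w∈ = begin
      pile (b ∷ bs) K w                          ≡⟨ pile-≢𝟎 (b ∷ bs) K w≢𝟎 ⟩
      indicator (member w) + multiplicity bs w   ≡⟨ cong₂ _+_ (if-T w∈) (disjoint w w∈) ⟩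
      1                                          ≡⟨ sym (initial-∈ shape (restrict-≢𝟎 w≢𝟎 w∈) (member-shape w∈)) ⟩
      initial shape (restrict thinning w)        ≡⟨ sym (lift-member _ _ w≢𝟎 w∈) ⟩
      lift (initial shape) (pile bs K) w         ∎
    ... | inj₂ w≢𝟎 | no w∉ = begin
      pile (b ∷ bs) K w                          ≡⟨ pile-≢𝟎 (b ∷ bs) K w≢𝟎 ⟩
      indicator (member w) + multiplicity bs w   ≡⟨ cong (_+ _) (if-¬T w∉) ⟩
      multiplicity bs w          ≡⟨ sym (pile-≢𝟎 bs K w≢𝟎) ⟩
      pile bs K w                                ≡⟨ sym (lift-outside _ _ w≢𝟎 w∉) ⟩
      lift (initial shape) (pile bs K) w         ∎

    after : ∀ w → lift final (pile bs K) w ≡ pile bs (K + final 𝟎) w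
    after w with toSum (w ≟V 𝟎) | T? (member w)
    ... | inj₁ refl | _ = begin
      lift final (pile bs K) 𝟎                   ≡⟨ lift-𝟎 _ _ ⟩
      pile bs K 𝟎 + final 𝟎                      ≡⟨ cong (_+ final 𝟎) (pile-𝟎 bs K) ⟩
      K + final 𝟎                                ≡⟨ sym (pile-𝟎 bs _) ⟩
      pile bs (K + final 𝟎) 𝟎                    ∎
    ... | inj₂ w≢𝟎 | yes w∈ = begin
      lift final (pile bs K) w                   ≡⟨ lift-member _ _ w≢𝟎 w∈ ⟩
      final (restrict thinning w)                ≡⟨ clears _ (restrict-≢𝟎 w≢𝟎 w∈) (member-shape w∈) ⟩
      0                                          ≡⟨ sym (disjoint w w∈) ⟩
      multiplicity bs w          ≡⟨ sym (pile-≢𝟎 bs _ w≢𝟎) ⟩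
      pile bs (K + final 𝟎) w                    ∎
    ... | inj₂ w≢𝟎 | no w∉ = begin
      lift final (pile bs K) w                   ≡⟨ lift-outside _ _ w≢𝟎 w∉ ⟩
      pile bs K w                                ≡⟨ pile-≢𝟎 bs K w≢𝟎 ⟩
      multiplicity bs w          ≡⟨ sym (pile-≢𝟎 bs _ w≢𝟎) ⟩
      pile bs (K + final 𝟎) w                    ∎

indicator≤1 : ∀ b → indicator b ≤ 1
indicator≤1 true  = s≤s z≤n
indicator≤1 false = z≤n

stack-blocks : ∀ {n k} (bs : List (Block n k)) {K} → (∀ w → multiplicity bs w ≤ 1) → 1 ≤ K →
  ∃[ K′ ] pile bs K ↝ pile {n} {k} [] K′
stack-blocks [] {K} _ _ = K , ↝-refl
stack-blocks (b ∷ bs) {K} at-most-one K≥1 =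
  map₂ (↝-trans (stack-block b bs disjoint K≥1))
       (stack-blocks bs (λ w → ≤-trans (m≤n+m _ _) (at-most-one w)) (≤-trans K≥1 (m≤m+n K _)))
  where
    disjoint : ∀ w → T (Block.member b w) → multiplicity bs w ≡ 0
    disjoint w w∈ = n≤0⇒n≡0 (≤-pred (subst (_≤ 1) (cong (_+ _) (if-T w∈)) (at-most-one w)))

stackable-by-blocks : ∀ {n k} (bs : List (Block n k)) (U : Vertex (n + k) → Bool) →
  (∀ w → multiplicity bs w ≡ indicator (U w)) → ZeroStackable (T ∘ U)
stackable-by-blocks {n} {k} bs U cover =
  let K′ , D , steps , D≗pile = stack-blocks bs at-most-one (s≤s z≤n)
  in  pile bs 1 , initial-pile , D , steps , λ w w≢𝟎 → trans (D≗pile w) (pile-≢𝟎 {n} {k} [] K′ w≢𝟎)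
  where
    at-most-one : ∀ w → multiplicity bs w ≤ 1
    at-most-one w = subst (_≤ 1) (sym (cover w)) (indicator≤1 (U w))

    initial-pile : IsInitial (T ∘ U) (pile bs 1)
    initial-pile w with w ≟V 𝟎
    ... | yes w≡𝟎 = (λ _ → refl) , (λ ∉ → contradiction (inj₂ w≡𝟎) ∉)
    ... | no w≢𝟎 rewrite cover w with U w
    ...   | true  = (λ _ → refl) , (λ ∉ → contradiction (inj₁ tt) ∉)
    ...   | false = Sum.[ (λ ()) , (λ w≡𝟎 → contradiction w≡𝟎 w≢𝟎) ] , (λ _ → refl)

ZeroStackable-cong : ∀ {d} {U U′ : VSet d} → (∀ w → U w ⇔ U′ w) →
  ZeroStackable U → ZeroStackable U′
ZeroStackable-cong U⇔U′ (C₀ , C₀-initial , C , steps , C-done) = C₀ , initial′ , C , steps , C-done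
  where
    initial′ : IsInitial _ C₀
    initial′ w =
      (λ u → proj₁ (C₀-initial w) (Sum.map₁ (Equivalence.from (U⇔U′ w)) u)) ,
      (λ ∉ → proj₂ (C₀-initial w) (λ u → ∉ (Sum.map₁ (Equivalence.to (U⇔U′ w)) u)))

-- Scripts are written with vertices as numbers, coordinate i being bit i.
fromBits : ∀ d → ℕ → Vertex d
fromBits zero _ = []
fromBits (suc d) x = (x % 2 ≡ᵇ 1) ∷ fromBits d (x / 2)

moves : ∀ {d} → List (ℕ × ℕ) → Script d
moves = map λ (u , v) → fromBits _ u , fromBits _ v

support : ∀ {n} (S : Vertex n) → weight S ⊑ n
support [] = done
support (true ∷ S) = keep (support S)
support (false ∷ S) = skip (support S)

allOnes : ∀ l {k} → Vertex (l + k) → Bool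
allOnes zero _ = true
allOnes (suc l) (b ∷ x) = b ∧ allOnes l x

module _ {k : ℕ} where

  cubeMember : ∀ {n} → Vertex n → Vertex (n + k) → Bool
  cubeMember S = Lift.member k (support S) (allOnes (weight S))

  cube-member : ∀ {n} (w : Vertex (n + k)) → T (cubeMember (take n w) w)
  cube-member {zero} w = tt
  cube-member {suc n} (true ∷ w) = cube-member {n} w
  cube-member {suc n} (false ∷ w) = cube-member {n} w

  cube-member⁻¹ : ∀ {n} (S : Vertex n) (w : Vertex (n + k)) → T (cubeMember S w) → take n w ≡ S
  cube-member⁻¹ [] w _ = refl
  cube-member⁻¹ (true ∷ S) (true ∷ w) w∈ = cong (true ∷_) (cube-member⁻¹ S w w∈)
  cube-member⁻¹ (true ∷ S) (false ∷ w) w∈ = ⊥-elim (proj₂ (T-∧-split w∈))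
  cube-member⁻¹ (false ∷ S) (false ∷ w) w∈ = cong (false ∷_) (cube-member⁻¹ S w w∈)

cubeCertificate : ∀ l → l ≤ 3 → Certificate (allOnes l {4})
cubeCertificate 0 _ = checked (moves (
    (1 , 0) ∷ (2 , 0) ∷ (4 , 0) ∷ (8 , 0) ∷ (3 , 7) ∷ (5 , 7) ∷ (7 , 0) ∷ (6 , 14) ∷ (10 , 14) ∷
    (14 , 0) ∷ (9 , 11) ∷ (15 , 11) ∷ (11 , 0) ∷ (13 , 12) ∷ (12 , 0) ∷ []))
cubeCertificate 1 _ = checked (moves (
    (1 , 0) ∷ (3 , 7) ∷ (5 , 7) ∷ (7 , 0) ∷ (9 , 11) ∷ (11 , 13) ∷ (13 , 0) ∷ (15 , 31) ∷
    (23 , 31) ∷ (17 , 19) ∷ (19 , 31) ∷ (31 , 0) ∷ (21 , 29) ∷ (29 , 27) ∷ (25 , 27) ∷ (27 , 0) ∷ []))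
cubeCertificate 2 _ = checked (moves (
    (3 , 35) ∷ (35 , 7) ∷ (7 , 0) ∷ (39 , 47) ∷ (43 , 47) ∷ (15 , 47) ∷ (63 , 47) ∷ (47 , 0) ∷
    (59 , 51) ∷ (19 , 51) ∷ (55 , 51) ∷ (51 , 0) ∷ (11 , 27) ∷ (27 , 23) ∷ (31 , 23) ∷ (23 , 0) ∷ []))
cubeCertificate 3 _ = checked (moves (
    (39 , 7) ∷ (7 , 103) ∷ (71 , 103) ∷ (103 , 31) ∷ (31 , 0) ∷ (15 , 47) ∷ (47 , 79) ∷
    (79 , 119) ∷ (111 , 127) ∷ (127 , 55) ∷ (23 , 55) ∷ (63 , 55) ∷ (55 , 0) ∷ (87 , 95) ∷
    (95 , 119) ∷ (119 , 0) ∷ []))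
cubeCertificate (suc (suc (suc (suc _)))) (s≤s (s≤s (s≤s ())))

cubeBlock : ∀ {n} (S : Vertex n) → weight S ≤ 3 → Block n 4
cubeBlock S l≤3 = record
  { dim = weight S ; thinning = support S ; shape = allOnes (weight S)
  ; certificate = cubeCertificate (weight S) l≤3 }

cube-stackable : ∀ {n} (S : Vertex n) → weight S ≤ 3 → ZeroStackable (kCube n 4 S)
cube-stackable {n} S l≤3 =
  ZeroStackable-cong cube⇔
    (stackable-by-blocks (cubeBlock S l≤3 ∷ []) (cubeMember S) (λ w → +-identityʳ _))
  where
    cube⇔ : ∀ w → T (cubeMember S w) ⇔ kCube n 4 S w
    cube⇔ w = mk⇔ (cube-member⁻¹ S w) λ w≡S → subst (λ S → T (cubeMember S w)) w≡S (cube-member {4} {n} w)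

data Kind : Set where
  1of2 1of3 2of3 3of4 4of5 : Kind

ones : Kind → ℕ
ones 1of2 = 1
ones 1of3 = 1
ones 2of3 = 2
ones 3of4 = 3
ones 4of5 = 4

width : Kind → ℕ
width 1of2 = 2
width 1of3 = 3
width 2of3 = 3
width 3of4 = 4
width 4of5 = 5

-- The labels of weight j that, on the chosen coordinates, start with `forced` ones followed by
-- exactly `ones kind` ones among `width kind` coordinates (and vanish off the chosen coordinates).
record WeightBlock (n j : ℕ) : Set where
  constructor weightBlock
  field
    kind     : Kind
    forced   : ℕ
    weight≡  : ones kind + forced ≡ j
    thinning : forced + width kind ⊑ n

profile : (t : Kind) (F : ℕ) → Vertex ((F + width t) + 3) → Bool
profile t zero x = weight (take (width t) x) ≡ᵇ ones t
profile t (suc F) (b ∷ x) = b ∧ profile t F x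

module _ {n j : ℕ} where

  memberW : WeightBlock n j → Vertex (n + 3) → Bool
  memberW (weightBlock t F _ p) = Lift.member 3 p (profile t F)

  multiplicityW : List (WeightBlock n j) → Vertex (n + 3) → ℕ
  multiplicityW bs w = count (λ b → memberW b w) bs

  Partition : List (WeightBlock n j) → Set
  Partition bs = ∀ w → multiplicityW bs w ≡ indicator (weight (take n w) ≡ᵇ j)

  partition? : (bs : List (WeightBlock n j)) → Dec (Partition bs)
  partition? bs = all-vertices? λ w → multiplicityW bs w ≟ indicator (weight (take n w) ≡ᵇ j)

  decide-partition : (bs : List (WeightBlock n j)) → {True (partition? bs)} → Partition bs
  decide-partition bs {ok} = toWitness ok

  skipW : WeightBlock n j → WeightBlock (suc n) j
  skipW (weightBlock t F e p) = weightBlock t F e (skip p)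

  keepW : WeightBlock n j → WeightBlock (suc n) (suc j)
  keepW (weightBlock t F e p) = weightBlock t (suc F) (trans (+-suc (ones t) F) (cong suc e)) (keep p)

pairBlock : ∀ n → WeightBlock (2 + n) 1
pairBlock n = weightBlock 1of2 0 refl (keep (keep (empty n)))

inSubcube-empty : ∀ {k} n (w : Vertex (n + k)) → Subcube.inSubcube k (empty n) w ≡ (weight (take n w) ≡ᵇ 0)
inSubcube-empty zero w = refl
inSubcube-empty (suc n) (true ∷ w) = refl
inSubcube-empty (suc n) (false ∷ w) = inSubcube-empty n w

-- A label of weight j+1 has weight j+1 or j after its first coordinate, according as that is 0 or 1.
partition-split : ∀ {n j} (bs : List (WeightBlock n (suc j))) (cs : List (WeightBlock n j)) →
  Partition bs → Partition cs → Partition (map skipW bs ++ map keepW cs)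
partition-split {n} {j} bs cs bs-part cs-part (b ∷ w) = begin
  multiplicityW (map skipW bs ++ map keepW cs) (b ∷ w)
    ≡⟨ count-++ _ (map skipW bs) (map keepW cs) ⟩
  multiplicityW (map skipW bs) (b ∷ w) + multiplicityW (map keepW cs) (b ∷ w)
    ≡⟨ cong₂ _+_ (count-map _ skipW bs) (count-map _ keepW cs) ⟩
  count (λ c → memberW (skipW c) (b ∷ w)) bs + count (λ c → memberW (keepW c) (b ∷ w)) cs
    ≡⟨ by-first-coordinate b ⟩
  indicator (weight (b ∷ take n w) ≡ᵇ suc j) ∎
  where
    open ≡-Reasoning
    by-first-coordinate : ∀ b →
      count (λ c → memberW (skipW c) (b ∷ w)) bs + count (λ c → memberW (keepW c) (b ∷ w)) cs
        ≡ indicator (weight (b ∷ take n w) ≡ᵇ suc j)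
    by-first-coordinate false = trans (cong₂ _+_ (bs-part w) (count-none _ cs λ _ → ∧-zeroʳ _)) (+-identityʳ _)
    by-first-coordinate true  = cong₂ _+_ (count-none _ bs λ _ → refl) (cs-part w)

partition-pairs : ∀ {n} (bs : List (WeightBlock n 1)) →
  Partition bs → Partition (map skipW (map skipW bs) ++ pairBlock n ∷ [])
partition-pairs {n} bs bs-part (a ∷ b ∷ w) = begin
  multiplicityW (map skipW (map skipW bs) ++ pairBlock n ∷ []) (a ∷ b ∷ w)
    ≡⟨ count-++ _ (map skipW (map skipW bs)) _ ⟩
  multiplicityW (map skipW (map skipW bs)) (a ∷ b ∷ w) + (indicator (memberW (pairBlock n) (a ∷ b ∷ w)) + 0)
    ≡⟨ cong₂ _+_ (trans (count-map _ skipW (map skipW bs)) (count-map _ skipW bs))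
                 (trans (+-identityʳ _) (cong indicator pair-member)) ⟩
  count (λ c → memberW (skipW (skipW c)) (a ∷ b ∷ w)) bs + indicator (empty-rest ∧ exactlyOne a b)
    ≡⟨ by-first-coordinates a b ⟩
  indicator (weight (a ∷ b ∷ take n w) ≡ᵇ 1) ∎
  where
    open ≡-Reasoning
    empty-rest : Bool
    empty-rest = weight (take n w) ≡ᵇ 0
    exactlyOne : Bool → Bool → Bool
    exactlyOne x y = weight (x ∷ y ∷ []) ≡ᵇ 1
    pair-member : memberW (pairBlock n) (a ∷ b ∷ w) ≡ empty-rest ∧ exactlyOne a b
    pair-member = cong (_∧ exactlyOne a b) (inSubcube-empty n w)
    by-first-coordinates : ∀ a b →
      count (λ c → memberW (skipW (skipW c)) (a ∷ b ∷ w)) bs + indicator (empty-rest ∧ exactlyOne a b)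
        ≡ indicator (weight (a ∷ b ∷ take n w) ≡ᵇ 1)
    by-first-coordinates false false = trans (cong₂ _+_ (bs-part w) (cong indicator (∧-zeroʳ _))) (+-identityʳ _)
    by-first-coordinates false true  = cong₂ _+_ (count-none _ bs λ _ → refl) (cong indicator (∧-identityʳ _))
    by-first-coordinates true  false = cong₂ _+_ (count-none _ bs λ _ → refl) (cong indicator (∧-identityʳ _))
    by-first-coordinates true  true  = cong₂ _+_ (count-none _ bs λ _ → refl) (cong indicator (∧-zeroʳ _))

blocks₁ : ∀ n → List (WeightBlock n 1)
blocks₁ 2 = pairBlock 0 ∷ []
blocks₁ 3 = weightBlock 1of3 0 refl (full 3) ∷ []
blocks₁ (suc (suc n@(suc (suc _)))) = map skipW (map skipW (blocks₁ n)) ++ pairBlock n ∷ []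
blocks₁ _ = []

blocks₂ : ∀ n → List (WeightBlock n 2)
blocks₂ 3 = weightBlock 2of3 0 refl (full 3) ∷ []
blocks₂ (suc n@(suc (suc (suc _)))) = map skipW (blocks₂ n) ++ map keepW (blocks₁ n)
blocks₂ _ = []

blocks₃ : ∀ n → List (WeightBlock n 3)
blocks₃ 4 = weightBlock 3of4 0 refl (full 4) ∷ []
blocks₃ (suc n@(suc (suc (suc (suc _))))) = map skipW (blocks₃ n) ++ map keepW (blocks₂ n)
blocks₃ _ = []

blocks₄ : ∀ n → List (WeightBlock n 4)
blocks₄ 5 = weightBlock 4of5 0 refl (full 5) ∷ []
blocks₄ (suc n@(suc (suc (suc (suc (suc _)))))) = map skipW (blocks₄ n) ++ map keepW (blocks₃ n)
blocks₄ _ = []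

blocks₁-partition : ∀ n → Partition (blocks₁ (2 + n))
blocks₁-partition 0 = decide-partition (blocks₁ 2)
blocks₁-partition 1 = decide-partition (blocks₁ 3)
blocks₁-partition (suc (suc n)) = partition-pairs (blocks₁ (2 + n)) (blocks₁-partition n)

blocks₂-partition : ∀ n → Partition (blocks₂ (3 + n))
blocks₂-partition 0 = decide-partition (blocks₂ 3)
blocks₂-partition (suc n) =
  partition-split (blocks₂ (3 + n)) (blocks₁ (3 + n)) (blocks₂-partition n) (blocks₁-partition (suc n))

blocks₃-partition : ∀ n → Partition (blocks₃ (4 + n))
blocks₃-partition 0 = decide-partition (blocks₃ 4)
blocks₃-partition (suc n) =
  partition-split (blocks₃ (4 + n)) (blocks₂ (4 + n)) (blocks₃-partition n) (blocks₂-partition (suc n))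

blocks₄-partition : ∀ n → Partition (blocks₄ (5 + n))
blocks₄-partition 0 = decide-partition (blocks₄ 5)
blocks₄-partition (suc n) =
  partition-split (blocks₄ (5 + n)) (blocks₃ (5 + n)) (blocks₄-partition n) (blocks₃-partition (suc n))

profileCertificate : ∀ t F → ones t + F ≡ 4 → Certificate (profile t F)
profileCertificate 1of2 .3 refl = checked (moves (
    (215 , 247) ∷ (247 , 239) ∷ (111 , 239) ∷ (175 , 239) ∷ (143 , 15) ∷ (47 , 15) ∷ (15 , 55) ∷
    (119 , 55) ∷ (55 , 0) ∷ (207 , 79) ∷ (79 , 239) ∷ (239 , 0) ∷ (87 , 23) ∷ (151 , 183) ∷
    (183 , 23) ∷ (23 , 0) ∷ []))
profileCertificate 1of3 .3 refl = checked (moves (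
    (143 , 15) ∷ (271 , 15) ∷ (15 , 151) ∷ (407 , 151) ∷ (151 , 0) ∷ (399 , 463) ∷ (207 , 463) ∷
    (335 , 463) ∷ (463 , 279) ∷ (279 , 0) ∷ (23 , 87) ∷ (87 , 79) ∷ (79 , 39) ∷ (39 , 0) ∷
    (167 , 423) ∷ (487 , 423) ∷ (423 , 103) ∷ (231 , 103) ∷ (103 , 0) ∷ (471 , 215) ∷ (215 , 343) ∷
    (343 , 295) ∷ (359 , 295) ∷ (295 , 0) ∷ []))
profileCertificate 2of3 .2 refl = checked (moves (
    (143 , 15) ∷ (15 , 23) ∷ (23 , 155) ∷ (27 , 155) ∷ (155 , 0) ∷ (151 , 183) ∷ (55 , 183) ∷
    (183 , 47) ∷ (47 , 87) ∷ (87 , 0) ∷ (175 , 239) ∷ (207 , 239) ∷ (111 , 239) ∷ (59 , 187) ∷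
    (187 , 219) ∷ (219 , 239) ∷ (239 , 0) ∷ (215 , 247) ∷ (119 , 247) ∷ (91 , 123) ∷ (251 , 123) ∷
    (123 , 79) ∷ (79 , 247) ∷ (247 , 0) ∷ []))
profileCertificate 3of4 .1 refl = checked (moves (
    (143 , 15) ∷ (15 , 23) ∷ (23 , 155) ∷ (27 , 155) ∷ (155 , 0) ∷ (151 , 183) ∷ (55 , 183) ∷
    (183 , 157) ∷ (29 , 157) ∷ (157 , 0) ∷ (47 , 175) ∷ (175 , 187) ∷ (59 , 187) ∷ (187 , 207) ∷
    (79 , 207) ∷ (207 , 0) ∷ (61 , 189) ∷ (189 , 221) ∷ (93 , 221) ∷ (221 , 119) ∷ (247 , 119) ∷
    (119 , 0) ∷ (215 , 87) ∷ (219 , 251) ∷ (251 , 239) ∷ (111 , 239) ∷ (239 , 91) ∷ (91 , 0) ∷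
    (253 , 125) ∷ (125 , 123) ∷ (123 , 87) ∷ (87 , 0) ∷ []))
profileCertificate 4of5 .0 refl = checked (moves (
    (254 , 222) ∷ (30 , 94) ∷ (222 , 221) ∷ (189 , 61) ∷ (47 , 15) ∷ (183 , 247) ∷ (59 , 27) ∷
    (239 , 111) ∷ (221 , 247) ∷ (23 , 151) ∷ (111 , 207) ∷ (79 , 15) ∷ (207 , 87) ∷ (155 , 27) ∷
    (15 , 94) ∷ (94 , 0) ∷ (61 , 93) ∷ (158 , 190) ∷ (187 , 251) ∷ (151 , 247) ∷ (247 , 0) ∷
    (190 , 175) ∷ (215 , 87) ∷ (87 , 0) ∷ (27 , 251) ∷ (91 , 123) ∷ (123 , 219) ∷ (93 , 119) ∷
    (175 , 157) ∷ (125 , 253) ∷ (219 , 143) ∷ (62 , 126) ∷ (126 , 119) ∷ (119 , 0) ∷ (29 , 157) ∷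
    (157 , 0) ∷ (253 , 251) ∷ (251 , 0) ∷ (143 , 55) ∷ (55 , 0) ∷ []))

certify : ∀ {n} → WeightBlock n 4 → Block n 3
certify (weightBlock t F e p) = record
  { dim = F + width t ; thinning = p ; shape = profile t F ; certificate = profileCertificate t F e }

union⇔weight : ∀ n w → T (weight (take n w) ≡ᵇ 4) ⇔ unionLevelCubes n 3 4 w
union⇔weight n w = mk⇔
  (λ w∈ → take n w , ≡ᵇ⇒≡ _ 4 w∈ , refl)
  (λ (S , S-weight , w∈S) → ≡⇒≡ᵇ _ 4 (trans (cong weight w∈S) S-weight))

union-stackable : ∀ n → ZeroStackable (unionLevelCubes (5 + n) 3 4)
union-stackable n =
  ZeroStackable-cong (union⇔weight (5 + n))
    (stackable-by-blocks (map certify (blocks₄ (5 + n))) (λ w → weight (take (5 + n) w) ≡ᵇ 4)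
      (λ w → trans (count-map _ certify (blocks₄ (5 + n))) (blocks₄-partition n w)))

lemma23 : ((l n : ℕ) → l ≤ 3 → l + 4 ≤ n + 4 → (S : Vec Bool n) → weight S ≡ l →
    ZeroStackable (kCube n 4 S))
    × ((n : ℕ) → 8 ≤ n + 3 → ZeroStackable (unionLevelCubes n 3 4))
lemma23 = level≤3-cubes , level-4-union
  where
    -- d ≥ l + 4 is automatic: a label of weight l has at least l coordinates.
    level≤3-cubes : (l n : ℕ) → l ≤ 3 → l + 4 ≤ n + 4 → (S : Vec Bool n) → weight S ≡ l →
      ZeroStackable (kCube n 4 S)
    level≤3-cubes l n l≤3 _ S refl = cube-stackable S l≤3

    level-4-union : (n : ℕ) → 8 ≤ n + 3 → ZeroStackable (unionLevelCubes n 3 4)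
    level-4-union n 8≤n+3 with m≤n⇒∃[o]m+o≡n (+-cancelʳ-≤ 3 5 n 8≤n+3)
    ... | o , refl = union-stackable o
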